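{- Let $J\subseteq C(n,2)$ be a realizable $2$-set, define $L^i,M^i$ as below, let $i\ge 2$, and let $K\subseteq C(n,i)$ be a realizable $i$-set with $L^i\subseteq K\subseteq M^i$. Then there is no $Y\in C(n,i+2)$ whose packet $P_Y$ is the union of the three nonempty sets $A=P_Y\cap(K_\emptyset\cap M^i_s)$, $B=P_Y\cap(K_\emptyset\cap M^i_F)$, $C=P_Y\cap(K_s\cap M^i_F)$ with $A<B<C$ (every element of $A$ lexicographically below every element of $B$, and every element of $B$ below every element of $C$).
   Context: $C(n,m)$: $m$-subsets of $\{1,\dots,n\}$ with lexicographic order on increasing sequences. For $X\in C(n,m+1)$, $P_X=\{Y\in C(n,m):Y\subset X\}$ with induced lexicographic order; prefix/suffix = initial/final segment. For $A\subseteq C(n,m)$ define subsets of $C(n,m+1)$: $A_p$ (resp. $A_s$) = $\{X:P_X\cap A$ a nonempty prefix (resp. suffix) of $P_X$ different from $P_X\}$, $A_F=\{X:P_X\subseteq A\}$, $A_\emptyset=\{X:P_X\cap A=\emptyset\}$. $A$ is realizable if $P_X\cap A$ is a prefix or suffix of $P_X$ for all $X$. Given realizable $J\subseteq C(n,2)$: $L^2=\emptyset$, $M^2=J$, and for $i\ge3$, $L^i=(M^{i-1})_s$, $M^i=(M^{i-1})_s\cup(M^{i-1}\setminus L^{i-1})_F$ (subsets of $C(n,i)$). -}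

module Defs where

open import Data.Nat using (ℕ; zero; suc; _+_; _≤_; _<_)
open import Data.List using (List; []; _∷_; length)
open import Data.List.Relation.Unary.All using (All)
open import Data.List.Relation.Unary.Linked using (Linked)
open import Data.List.Relation.Binary.Sublist.Propositional using (_⊆_)
open import Data.Product using (Σ; _×_; _,_; ∃)
open import Data.Sum using (_⊎_)
open import Data.Empty using (⊥)
open import Relation.Nullary using (¬_)
open import Relation.Binary.PropositionalEquality using (_≡_)

-- A finite set is represented as an increasing list of naturals.
-- IsComb n m X : X ∈ C(n,m), i.e. X is a strictly increasing list of
-- length m with entries in {1,…,n}.
IsComb : ℕ → ℕ → List ℕ → Set
IsComb n m X = (length X ≡ m) × All (λ x → 1 ≤ x × x ≤ n) X × Linked _<_ X

data _<ₗ_ : List ℕ → List ℕ → Set where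
  here  : ∀ {x y xs ys} → x < y → (x ∷ xs) <ₗ (y ∷ ys)
  there : ∀ {x xs ys} → xs <ₗ ys → (x ∷ xs) <ₗ (x ∷ ys)

Family : Set₁
Family = List ℕ → Set

∅F : Family
∅F _ = ⊥

_∪F_ : Family → Family → Family
(A ∪F B) X = A X ⊎ B X

_∩F_ : Family → Family → Family
(A ∩F B) X = A X × B X

_∖F_ : Family → Family → Family
(A ∖F B) X = A X × ¬ B X

-- Packet: for X ∈ C(n,m+1), Y ∈ P_X iff Y ∈ C(n,m) and Y ⊂ X
-- (for increasing lists, subset = sublist).
InPacket : ℕ → ℕ → List ℕ → List ℕ → Set
InPacket n m X Y = IsComb n m Y × Y ⊆ X

IsPrefixIn : ℕ → ℕ → Family → List ℕ → Set
IsPrefixIn n m A X = ∀ Y Y′ → InPacket n m X Y → InPacket n m X Y′ →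
                     Y <ₗ Y′ → A Y′ → A Y

IsSuffixIn : ℕ → ℕ → Family → List ℕ → Set
IsSuffixIn n m A X = ∀ Y Y′ → InPacket n m X Y → InPacket n m X Y′ →
                     Y <ₗ Y′ → A Y → A Y′

Realizable : ℕ → ℕ → Family → Set
Realizable n m A = ∀ X → IsComb n (suc m) X → IsPrefixIn n m A X ⊎ IsSuffixIn n m A X

NonemptyIn : ℕ → ℕ → Family → List ℕ → Set
NonemptyIn n m A X = Σ (List ℕ) λ Y → InPacket n m X Y × A Y

ProperIn : ℕ → ℕ → Family → List ℕ → Set
ProperIn n m A X = Σ (List ℕ) λ Y → InPacket n m X Y × ¬ A Y

opP : ℕ → ℕ → Family → Family
opP n m A X = IsComb n (suc m) X × NonemptyIn n m A X × ProperIn n m A X × IsPrefixIn n m A X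

opS : ℕ → ℕ → Family → Family
opS n m A X = IsComb n (suc m) X × NonemptyIn n m A X × ProperIn n m A X × IsSuffixIn n m A X

opF : ℕ → ℕ → Family → Family
opF n m A X = IsComb n (suc m) X × (∀ Y → InPacket n m X Y → A Y)

opE : ℕ → ℕ → Family → Family
opE n m A X = IsComb n (suc m) X × (∀ Y → InPacket n m X Y → ¬ A Y)

-- LMaux n J k = (L^{k+2}, M^{k+2}).
LMaux : ℕ → Family → ℕ → Family × Family
LMaux n J zero = ∅F , J
LMaux n J (suc k) with LMaux n J k
... | (L , M) = opS n (2 + k) M , (opS n (2 + k) M ∪F opF n (2 + k) (M ∖F L))

-- L^i and M^i for i ≥ 2 (values for i < 2 are irrelevant; they equal L^2, M^2).
Lfam : ℕ → Family → ℕ → Family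
Lfam n J i = Data.Product.proj₁ (LMaux n J (i Data.Nat.∸ 2))

Mfam : ℕ → Family → ℕ → Family
Mfam n J i = Data.Product.proj₂ (LMaux n J (i Data.Nat.∸ 2))

-- The forbidden configuration: Y ∈ C(n,i+2) with P_Y = A ∪ B ∪ C,
-- A = P_Y ∩ (K_∅ ∩ M_s), B = P_Y ∩ (K_∅ ∩ M_F), C = P_Y ∩ (K_s ∩ M_F),
-- A, B, C nonempty and A < B < C.
BadPacket : ℕ → ℕ → Family → Family → List ℕ → Set
BadPacket n i K M Y =
  let m = suc i
      A = opE n i K ∩F opS n i M
      B = opE n i K ∩F opF n i M
      C = opS n i K ∩F opF n i M
      inP = InPacket n m Y
  in IsComb n (2 + i) Y
   × (∀ Z → inP Z → A Z ⊎ B Z ⊎ C Z)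
   × (Σ (List ℕ) λ Z → inP Z × A Z)
   × (Σ (List ℕ) λ Z → inP Z × B Z)
   × (Σ (List ℕ) λ Z → inP Z × C Z)
   × (∀ Z Z′ → inP Z → inP Z′ → A Z → B Z′ → Z <ₗ Z′)
   × (∀ Z Z′ → inP Z → inP Z′ → B Z → C Z′ → Z <ₗ Z′)

{-# OPTIONS --safe #-}

-- For every i, M^i ∖ L^i consists exactly of the i-sets all of whose pairs
-- lie in J. In a bad packet Y, let b and c be the elements missing from
-- members of B and C, and d the element of that member of C missing from a
-- K-member W₁ of its packet. Then Y ∖ b, Y ∖ c, Y ∖ d all lie in M_F (Y ∖ d
-- contains W₁, so it is not in K_∅), and b ∈ W₁ since Y ∖ b ∈ K_∅; hence
-- b, c, d are distinct. Take Z in A and W ∉ M in its packet. Every pair of W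
-- avoids some x ∈ {b, c, d}. If x ∉ Z then W ⊆ Z ⊆ Y ∖ x, so W ∈ M.
-- Otherwise Z ∖ x lies in the packet of Y ∖ x, hence in M, but not in K ⊇ L
-- because Z ∈ K_∅; so Z ∖ x ∈ M ∖ L, and the pair lies in J. Thus all pairs
-- of W lie in J, which forces W ∈ M.
module Submission where

open import Defs
open import Data.Nat using (ℕ; _≤_)
open import Data.List using (List)
open import Data.Product using (∃)
open import Relation.Nullary using (¬_)

open import Level using (Level)
open import Data.Nat using (zero; suc; _+_; _<_; z≤n; s≤s)
import Data.Nat.Properties as ℕ
open import Data.List using ([]; _∷_; length)
open import Data.List.Membership.Propositional using (_∈_; _∉_)
open import Data.List.Membership.DecPropositional ℕ._≟_ using (_∈?_)
import Data.List.Relation.Unary.All as All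
open import Data.List.Relation.Unary.Any using (here; there; tail; any?)
open import Data.List.Relation.Unary.AllPairs using (AllPairs; []; _∷_)
open import Data.List.Relation.Unary.Linked.Properties using (Linked⇒AllPairs; AllPairs⇒Linked)
open import Data.List.Relation.Binary.Sublist.Propositional
  using (_⊆_; []; _∷_; _∷ʳ_; ⊆-refl; ⊆-trans; lookup; minimum)
open import Data.List.Relation.Binary.Sublist.Propositional.Properties using (All-resp-⊆; to-≋)
open import Data.List.Relation.Binary.Equality.Propositional using (≋⇒≡)
open import Data.Product using (_×_; _,_; proj₁; proj₂; uncurry)
open import Data.Sum using (_⊎_; inj₁; inj₂; [_,_])
open import Data.Empty using (⊥-elim)
open import Relation.Nullary using (yes; no)
open import Relation.Binary.Core using (Rel)
open import Relation.Binary.Definitions using (Irreflexive; Transitive; DecidableEquality)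
open import Relation.Binary.PropositionalEquality
  using (_≡_; _≢_; refl; sym; trans; subst; subst₂; cong)

private
  variable
    a ℓ : Level
    A : Set a

AllPairs-resp-⊆ : {R : Rel A ℓ} {xs ys : List A} → xs ⊆ ys → AllPairs R ys → AllPairs R xs
AllPairs-resp-⊆ []         []       = []
AllPairs-resp-⊆ (_ ∷ʳ τ)   (_ ∷ rs) = AllPairs-resp-⊆ τ rs
AllPairs-resp-⊆ (refl ∷ τ) (r ∷ rs) = All-resp-⊆ τ r ∷ AllPairs-resp-⊆ τ rs

record IsDeletion {a} {A : Set a} (xs : List A) (x : A) (zs : List A) : Set a where
  field
    sub     : zs ⊆ xs
    member  : x ∈ xs
    missing : x ∉ zs
    keeps   : ∀ {y} → y ∈ xs → y ≢ x → y ∈ zs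

open IsDeletion

pair-has-no-three-distinct : {p q b c d : A} → b ≢ c → b ≢ d → c ≢ d →
                             b ∈ p ∷ q ∷ [] → c ∈ p ∷ q ∷ [] → d ∉ p ∷ q ∷ []
pair-has-no-three-distinct b≢c _   _   (here refl)         (here refl)         _                   = b≢c refl
pair-has-no-three-distinct _   b≢d _   (here refl)         (there (here refl)) (here refl)         = b≢d refl
pair-has-no-three-distinct _   _   c≢d (here refl)         (there (here refl)) (there (here refl)) = c≢d refl
pair-has-no-three-distinct _   _   c≢d (there (here refl)) (here refl)         (here refl)         = c≢d refl
pair-has-no-three-distinct _   b≢d _   (there (here refl)) (here refl)         (there (here refl)) = b≢d refl
pair-has-no-three-distinct b≢c _   _   (there (here refl)) (there (here refl)) _                   = b≢c refl

pair-omits-one-of-three : DecidableEquality A → {P : List A} {b c d : A} → length P ≡ 2 →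
                          b ≢ c → b ≢ d → c ≢ d → b ∉ P ⊎ c ∉ P ⊎ d ∉ P
pair-omits-one-of-three _≟_ {P@(_ ∷ _ ∷ [])} {b} {c} {d} refl b≢c b≢d c≢d
  with any? (b ≟_) P | any? (c ≟_) P | any? (d ≟_) P
... | no b∉P  | _       | _       = inj₁ b∉P
... | yes _   | no c∉P  | _       = inj₂ (inj₁ c∉P)
... | yes _   | yes _   | no d∉P  = inj₂ (inj₂ d∉P)
... | yes b∈P | yes c∈P | yes d∈P = ⊥-elim (pair-has-no-three-distinct b≢c b≢d c≢d b∈P c∈P d∈P)

module StrictlyIncreasing {_≺_ : Rel A ℓ}
  (≺-irrefl : Irreflexive _≡_ _≺_) (≺-trans : Transitive _≺_) where

  Increasing : List A → Set _
  Increasing = AllPairs _≺_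

  head-∉-tail : ∀ {x xs} → Increasing (x ∷ xs) → x ∉ xs
  head-∉-tail (x≺xs ∷ _) x∈xs = ≺-irrefl refl (All.lookup x≺xs x∈xs)

  ⊆-from-∈ : ∀ {zs xs} → Increasing zs → Increasing xs →
             (∀ {w} → w ∈ zs → w ∈ xs) → zs ⊆ xs
  ⊆-from-∈ {[]}     _ _ _ = minimum _
  ⊆-from-∈ {_ ∷ _}  {[]} _ _ zs⊆xs with () ← zs⊆xs (here refl)
  ⊆-from-∈ {z ∷ zs} {x ∷ xs} z∷zs↑@(z≺zs ∷ zs↑) (x≺xs ∷ xs↑) zs⊆xs with zs⊆xs (here refl)
  ... | here refl  = refl ∷ ⊆-from-∈ zs↑ xs↑ λ w∈zs →
    tail (λ { refl → ≺-irrefl refl (All.lookup z≺zs w∈zs) }) (zs⊆xs (there w∈zs))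
  ... | there z∈xs = x ∷ʳ ⊆-from-∈ z∷zs↑ xs↑ λ w∈z∷zs →
    tail (λ { refl → ≺-irrefl refl (x≺w w∈z∷zs) }) (zs⊆xs w∈z∷zs)
    where
    x≺w : ∀ {w} → w ∈ z ∷ zs → x ≺ w
    x≺w (here refl)   = All.lookup x≺xs z∈xs
    x≺w (there w∈zs) = ≺-trans (All.lookup x≺xs z∈xs) (All.lookup z≺zs w∈zs)

  ∃-∉-of-shorter-⊆ : ∀ {zs xs} → Increasing xs → zs ⊆ xs → length zs < length xs →
                     ∃ λ x → x ∈ xs × x ∉ zs
  ∃-∉-of-shorter-⊆ xs↑ (y ∷ʳ τ) _ = y , here refl , λ y∈zs → head-∉-tail xs↑ (lookup τ y∈zs)
  ∃-∉-of-shorter-⊆ xs↑@(_ ∷ ys↑) (refl ∷ τ) (s≤s shorter) with ∃-∉-of-shorter-⊆ ys↑ τ shorter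
  ... | x , x∈ys , x∉zs = x , there x∈ys , λ where
    (here refl)  → head-∉-tail xs↑ x∈ys
    (there x∈zs) → x∉zs x∈zs

  delete : ∀ {x xs} → Increasing xs → x ∈ xs →
           ∃ λ zs → IsDeletion xs x zs × suc (length zs) ≡ length xs
  delete {xs = x ∷ xs} xs↑ (here refl) = xs , deletion , refl
    where
    deletion : IsDeletion (x ∷ xs) x xs
    deletion = record { sub = x ∷ʳ ⊆-refl ; member = here refl ; missing = head-∉-tail xs↑
                      ; keeps = λ y∈ y≢x → tail y≢x y∈ }
  delete {x} {y ∷ ys} xs↑@(y≺ys ∷ ys↑) (there x∈ys) with delete ys↑ x∈ys
  ... | zs , d , len = y ∷ zs , deletion , cong suc len
    where
    deletion : IsDeletion (y ∷ ys) x (y ∷ zs)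
    deletion = record
      { sub     = refl ∷ sub d
      ; member  = there (member d)
      ; missing = λ where
          (here refl)  → head-∉-tail xs↑ x∈ys
          (there x∈zs) → missing d x∈zs
      ; keeps   = λ where
          (here refl)  _   → here refl
          (there w∈ys) w≢x → there (keeps d w∈ys w≢x)
      }

  deletion-⊆ : ∀ {xs x zs ws} → Increasing xs → IsDeletion xs x zs →
               ws ⊆ xs → x ∉ ws → ws ⊆ zs
  deletion-⊆ xs↑ d ws⊆xs x∉ws =
    ⊆-from-∈ (AllPairs-resp-⊆ ws⊆xs xs↑) (AllPairs-resp-⊆ (sub d) xs↑)
      λ w∈ws → keeps d (lookup ws⊆xs w∈ws) λ { refl → x∉ws w∈ws }

  deleted-element : ∀ {xs zs} → Increasing xs → zs ⊆ xs → suc (length zs) ≡ length xs →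
                    ∃ λ x → IsDeletion xs x zs
  deleted-element xs↑ zs⊆xs len
    with ∃-∉-of-shorter-⊆ xs↑ zs⊆xs (subst (_ <_) len ℕ.≤-refl)
  ... | x , x∈xs , x∉zs with delete xs↑ x∈xs
  ... | zs′ , d , len′ = x , subst (IsDeletion _ x) (sym zs≡zs′) d
    where
    zs≡zs′ : _ ≡ zs′
    zs≡zs′ = ≋⇒≡ (to-≋ (ℕ.suc-injective (trans len (sym len′)))
                       (deletion-⊆ xs↑ d zs⊆xs x∉zs))

open StrictlyIncreasing ℕ.<-irrefl ℕ.<-trans

increasing : ∀ {n m X} → IsComb n m X → Increasing X
increasing (_ , _ , X↑) = Linked⇒AllPairs ℕ.<-trans X↑

IsComb-⊆ : ∀ {n m k Z X} → Z ⊆ X → IsComb n m X → length Z ≡ k → IsComb n k Z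
IsComb-⊆ Z⊆X X∈C@(_ , bounded , _) len =
  len , All-resp-⊆ Z⊆X bounded , AllPairs⇒Linked (AllPairs-resp-⊆ Z⊆X (increasing X∈C))

delete-from-comb : ∀ {n m X x} → IsComb n (suc m) X → x ∈ X →
                   ∃ λ Z → InPacket n m X Z × IsDeletion X x Z
delete-from-comb X∈C@(lenX , _) x∈X with delete (increasing X∈C) x∈X
... | Z , d , lenZ = Z , (IsComb-⊆ (sub d) X∈C (ℕ.suc-injective (trans lenZ lenX)) , sub d) , d

deleted-element-of-packet : ∀ {n m X Z} → IsComb n (suc m) X → InPacket n m X Z →
                            ∃ λ x → IsDeletion X x Z
deleted-element-of-packet X∈C@(lenX , _) ((lenZ , _) , Z⊆X) =
  deleted-element (increasing X∈C) Z⊆X (trans (cong suc lenZ) (sym lenX))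

Clique : Family → List ℕ → Set
Clique J X = ∀ P → P ⊆ X → length P ≡ 2 → J P

Clique-⊆ : ∀ {J W X} → W ⊆ X → Clique J X → Clique J W
Clique-⊆ W⊆X clique P P⊆W = clique P (⊆-trans P⊆W W⊆X)

module _ {n : ℕ} {J : Family} where

  Clique⇒M∖L : ∀ k {X} → IsComb n (2 + k) X → Clique J X →
               Mfam n J (2 + k) X × ¬ Lfam n J (2 + k) X
  Clique⇒M∖L zero    X∈C clique = clique _ ⊆-refl (proj₁ X∈C) , λ ()
  Clique⇒M∖L (suc k) X∈C clique =
    inj₂ (X∈C , packet⊆M∖L) , λ (_ , _ , (V , V∈P , V∉M) , _) → V∉M (proj₁ (packet⊆M∖L V V∈P))
    where
    packet⊆M∖L : ∀ V → InPacket n (2 + k) _ V → Mfam n J (2 + k) V × ¬ Lfam n J (2 + k) V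
    packet⊆M∖L V (V∈C , V⊆X) = Clique⇒M∖L k V∈C (Clique-⊆ V⊆X clique)

  M∖L⇒Clique : ∀ k {X} → IsComb n (2 + k) X →
               Mfam n J (2 + k) X → ¬ Lfam n J (2 + k) X → Clique J X
  M∖L⇒Clique zero X∈C J[X] _ P P⊆X len =
    subst J (sym (≋⇒≡ (to-≋ (trans len (sym (proj₁ X∈C))) P⊆X))) J[X]
  M∖L⇒Clique (suc k) _ (inj₁ X∈L) X∉L = ⊥-elim (X∉L X∈L)
  M∖L⇒Clique (suc k) X∈C@(lenX , _) (inj₂ (_ , packet⊆M∖L)) _ P P⊆X len
    with ∃-∉-of-shorter-⊆ (increasing X∈C) P⊆X
           (subst₂ _<_ (sym len) (sym lenX) (s≤s (s≤s (s≤s z≤n))))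
  ... | x , x∈X , x∉P with delete-from-comb X∈C x∈X
  ... | V , V∈P , d = uncurry (M∖L⇒Clique k (proj₁ V∈P)) (packet⊆M∖L V V∈P)
                        P (deletion-⊆ (increasing X∈C) d P⊆X x∉P) len

DeletionIn : Family → List ℕ → ℕ → Set
DeletionIn F Y x = ∃ λ Z → IsDeletion Y x Z × F Z

three-distinct-full-deletions : ∀ {n i K M Y} → BadPacket n i K M Y →
  ∃ λ b → ∃ λ c → ∃ λ d → b ≢ c × b ≢ d × c ≢ d ×
    DeletionIn (opF n i M) Y b × DeletionIn (opF n i M) Y c × DeletionIn (opF n i M) Y d
three-distinct-full-deletions {n} {i} {K} {M} {Y}
  (Y∈C , cover , _ , (Zb , Zb∈P , Zb∈K∅ , Zb∈MF)
                   , (Zc , Zc∈P , (_ , (W₁ , W₁∈P , W₁∈K) , _) , Zc∈MF) , _)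
  with deleted-element-of-packet Y∈C Zb∈P | deleted-element-of-packet Y∈C Zc∈P
     | deleted-element-of-packet (proj₁ Zc∈P) W₁∈P
... | b , Y∖b | c , Y∖c | d , Zc∖d with delete-from-comb Y∈C (lookup (proj₂ Zc∈P) (member Zc∖d))
... | Zd , Zd∈P , Y∖d =
  b , c , d , b≢c , b≢d , c≢d , (Zb , Y∖b , Zb∈MF) , (Zc , Y∖c , Zc∈MF) , (Zd , Y∖d , Zd∈MF)
  where
  W₁⊆Y : W₁ ⊆ Y
  W₁⊆Y = ⊆-trans (proj₂ W₁∈P) (proj₂ Zc∈P)

  W₁∈P[Zd] : InPacket n i Zd W₁
  W₁∈P[Zd] = proj₁ W₁∈P , deletion-⊆ (increasing Y∈C) Y∖d W₁⊆Y (missing Zc∖d)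

  Zd∈MF : opF n i M Zd
  Zd∈MF with cover Zd Zd∈P
  ... | inj₁ ((_ , avoidsK) , _)        = ⊥-elim (avoidsK W₁ W₁∈P[Zd] W₁∈K)
  ... | inj₂ (inj₁ ((_ , avoidsK) , _)) = ⊥-elim (avoidsK W₁ W₁∈P[Zd] W₁∈K)
  ... | inj₂ (inj₂ (_ , Zd∈MF))        = Zd∈MF

  b∈W₁ : b ∈ W₁
  b∈W₁ with b ∈? W₁
  ... | yes b∈W₁ = b∈W₁
  ... | no b∉W₁  =
    ⊥-elim (proj₂ Zb∈K∅ W₁ (proj₁ W₁∈P , deletion-⊆ (increasing Y∈C) Y∖b W₁⊆Y b∉W₁) W₁∈K)

  b≢c : b ≢ c
  b≢c refl = missing Y∖c (lookup (proj₂ W₁∈P) b∈W₁)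

  b≢d : b ≢ d
  b≢d refl = missing Zc∖d b∈W₁

  c≢d : c ≢ d
  c≢d refl = missing Y∖c (member Zc∖d)

module _ {n k : ℕ} {J K : Family} (L⊆K : ∀ X → Lfam n J (2 + k) X → K X) where

  private
    M : Family
    M = Mfam n J (2 + k)

  pair-avoiding-full-deletion∈J :
    ∀ {Y Z W x} → IsComb n (4 + k) Y → InPacket n (3 + k) Y Z → opE n (2 + k) K Z →
    InPacket n (2 + k) Z W → ¬ M W → DeletionIn (opF n (2 + k) M) Y x →
    ∀ P → P ⊆ W → length P ≡ 2 → x ∉ P → J P
  pair-avoiding-full-deletion∈J {Z = Z} {W} {x} Y∈C (Z∈C , Z⊆Y) Z∈K∅ (W∈C , W⊆Z) W∉M
    (Y∖x , Y∖x-del , Y∖x∈MF) P P⊆W len x∉P with x ∈? Z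
  ... | no x∉Z = ⊥-elim (W∉M (proj₂ Y∖x∈MF W
                   (W∈C , ⊆-trans W⊆Z (deletion-⊆ (increasing Y∈C) Y∖x-del Z⊆Y x∉Z))))
  ... | yes x∈Z with delete-from-comb Z∈C x∈Z
  ... | Z∖x , (Z∖x∈C , Z∖x⊆Z) , Z∖x-del =
    M∖L⇒Clique k Z∖x∈C Z∖x∈M Z∖x∉L
      P (deletion-⊆ (increasing Z∈C) Z∖x-del (⊆-trans P⊆W W⊆Z) x∉P) len
    where
    Z∖x∈M : M Z∖x
    Z∖x∈M = proj₂ Y∖x∈MF Z∖x
      (Z∖x∈C , deletion-⊆ (increasing Y∈C) Y∖x-del (⊆-trans Z∖x⊆Z Z⊆Y) (missing Z∖x-del))

    Z∖x∉L : ¬ Lfam n J (2 + k) Z∖x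
    Z∖x∉L Z∖x∈L = proj₂ Z∈K∅ Z∖x (Z∖x∈C , Z∖x⊆Z) (L⊆K Z∖x Z∖x∈L)

lemma4p17 : (n : ℕ) (J : Family) → (∀ X → J X → IsComb n 2 X) → Realizable n 2 J →
            (i : ℕ) → 2 ≤ i → (K : Family) → Realizable n i K →
            (∀ X → Lfam n J i X → K X) → (∀ X → K X → Mfam n J i X) →
            ¬ (∃ λ (Y : List ℕ) → BadPacket n i K (Mfam n J i) Y)
lemma4p17 n J _ _ (suc (suc k)) (s≤s (s≤s z≤n)) K _ L⊆K _
  (Y , bad@(Y∈C , _ , (Z , Z∈P , Z∈K∅ , (_ , _ , (W , W∈P , W∉M) , _)) , _))
  with three-distinct-full-deletions bad
... | b , c , d , b≢c , b≢d , c≢d , Y∖b , Y∖c , Y∖d =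
  W∉M (proj₁ (Clique⇒M∖L k (proj₁ W∈P) W-clique))
  where
  W-clique : Clique J W
  W-clique P P⊆W len =
    [ avoiding Y∖b , [ avoiding Y∖c , avoiding Y∖d ] ] (pair-omits-one-of-three ℕ._≟_ len b≢c b≢d c≢d)
    where
    avoiding : ∀ {x} → DeletionIn (opF n (2 + k) (Mfam n J (2 + k))) Y x → x ∉ P → J P
    avoiding Y∖x = pair-avoiding-full-deletion∈J L⊆K Y∈C Z∈P Z∈K∅ W∈P W∉M Y∖x P P⊆W len
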